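{- Let $p\ge 3$. Then ${\rm gp}(S_p^2)=\frac{(p+1)^2}{4}$ if $p$ is odd and ${\rm gp}(S_p^2)=\frac{p(p+2)}{4}$ if $p$ is even. Moreover, the number of general position sets of $S_p^2$ of cardinality ${\rm gp}(S_p^2)$ equals $\binom{p}{(p+1)/2}$ if $p$ is odd and $\binom{p+1}{(p+2)/2}$ if $p$ is even.
   Context: For $p\ge 3$, $n\ge1$, the Sierpiński graph $S_p^n$ has vertex set $\{0,1,\dots,p-1\}^n$ (vertices written as words $i_1\cdots i_n$), and $i_1\cdots i_n$ is adjacent to $j_1\cdots j_n$ iff there is $h\in\{1,\dots,n\}$ with $i_t=j_t$ for all $t<h$, $i_h\ne j_h$, and $i_t=j_h$, $j_t=i_h$ for all $t>h$. For a graph $G$ and $X\subseteq V(G)$, vertices $u,v$ are $X$-positionable if every shortest $u,v$-path $P$ satisfies $V(P)\cap X\subseteq\{u,v\}$; $X$ is a general position set if any two vertices of $X$ are $X$-positionable; ${\rm gp}(G)$ is the maximum size of a general position set. -}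

module Defs where

open import Data.Nat using (ℕ; zero; suc; _≤_)
open import Data.Fin using (Fin; toℕ) renaming (_<_ to _<ᶠ_)
open import Data.Vec using (Vec; []; _∷_; lookup; map; sum)
open import Data.Bool using (Bool; true; false)
open import Data.Product using (Σ; ∃; _×_)
open import Data.Sum using (_⊎_)
open import Data.List using (List; length)
open import Data.List.Membership.Propositional using (_∈_)
open import Data.List.Relation.Unary.All using (All)
open import Data.List.Relation.Unary.Unique.Propositional using (Unique)
open import Relation.Binary.PropositionalEquality using (_≡_; _≢_)

Word : ℕ → ℕ → Set
Word p n = Vec (Fin p) n

Adj : (p n : ℕ) → Word p n → Word p n → Set
Adj p n i j = Σ (Fin n) λ h →
    (∀ (t : Fin n) → t <ᶠ h → lookup i t ≡ lookup j t)
  × (lookup i h ≢ lookup j h)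
  × (∀ (t : Fin n) → h <ᶠ t → (lookup i t ≡ lookup j h) × (lookup j t ≡ lookup i h))

data Walk (p n : ℕ) : Word p n → Word p n → ℕ → Set where
  stay : (u : Word p n) → Walk p n u u 0
  step : {u w v : Word p n} {k : ℕ} → Adj p n u w → Walk p n w v k → Walk p n u v (suc k)

data OnWalk {p n : ℕ} (x : Word p n) : {u v : Word p n} {k : ℕ} → Walk p n u v k → Set where
  here-stay : OnWalk x (stay x)
  here-step : {w v : Word p n} {k : ℕ} (a : Adj p n x w) (W : Walk p n w v k) → OnWalk x (step {u = x} a W)
  there : {u w v : Word p n} {k : ℕ} (a : Adj p n u w) (W : Walk p n w v k) →
          OnWalk x W → OnWalk x (step {u = u} a W)

-- A shortest u,v-path: a u,v-walk whose length is at most that of every u,v-walk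
-- (such a walk is automatically a path).
IsShortest : {p n : ℕ} {u v : Word p n} {k : ℕ} → Walk p n u v k → Set
IsShortest {p} {n} {u} {v} {k} _ = ∀ (m : ℕ) → Walk p n u v m → k ≤ m

-- Subsets of the vertex set {0..p-1}^n, represented extensionally as a trie
-- (so propositional equality of subsets is equality of sets).
VSet : ℕ → ℕ → Set
VSet p zero = Bool
VSet p (suc n) = Vec (VSet p n) p

_∈V_ : {p n : ℕ} → Word p n → VSet p n → Set
_∈V_ [] b = b ≡ true
_∈V_ (i ∷ w) X = w ∈V lookup X i

card : {p n : ℕ} → VSet p n → ℕ
card {p} {zero} true = 1
card {p} {zero} false = 0
card {p} {suc n} X = sum (map card X)

Positionable : {p n : ℕ} → VSet p n → Word p n → Word p n → Set
Positionable {p} {n} X u v =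
  ∀ {k : ℕ} (P : Walk p n u v k) → IsShortest P →
  ∀ (x : Word p n) → OnWalk x P → x ∈V X → (x ≡ u) ⊎ (x ≡ v)

IsGPSet : {p n : ℕ} → VSet p n → Set
IsGPSet {p} {n} X = ∀ (u v : Word p n) → u ∈V X → v ∈V X → u ≢ v → Positionable X u v

GPNumber : (p n g : ℕ) → Set
GPNumber p n g =
  (Σ (VSet p n) λ X → IsGPSet X × card X ≡ g)
  × (∀ (X : VSet p n) → IsGPSet X → card X ≤ g)

NumGPSetsOfSize : (p n g c : ℕ) → Set
NumGPSetsOfSize p n g c = Σ (List (VSet p n)) λ L →
    Unique L
  × All (λ X → IsGPSet X × card X ≡ g) L
  × (∀ (X : VSet p n) → IsGPSet X → card X ≡ g → X ∈ L)
  × length L ≡ c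

module Submission where

-- In S_p^2 the distance from a b to c d is [b ≢ d] inside a copy (a ≡ c) and
-- [b ≢ c] + 1 + [a ≢ d] between copies, because the only edge joining the copies a and c is
-- {a c, c a}. Hence a c lies on a shortest path from a b to every c d with b ≢ c, so a general
-- position set X whose rows a and c are nonempty contains a c only as the single vertex of its
-- row a. Writing Y for the set of nonempty rows and m = p − |Y|, every row of X therefore has
-- at most m + 1 vertices, and |X| ≤ |Y| (m + 1). Conversely, for every A the set of a b with
-- a ∈ A and (b ≡ a or b ∉ A) is in general position, since two of its vertices in different
-- copies are at distance 3 and no third vertex lies between them; it has |A| (p − |A| + 1)
-- vertices, and when m ≥ 1 a general position set attaining |Y| (m + 1) is this set for A = Y.
-- Maximising k (p − k + 1) gives k = (p + 1)/2 for odd p and k ∈ {p/2, p/2 + 1} for even p,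
-- so the maximum sets correspond to the k-subsets of {0, …, p − 1} for these k.

open import Data.Bool using (Bool; true; false; not; _∧_; _∨_; if_then_else_)
open import Data.Bool.Properties using (∧-identityʳ) renaming (_≟_ to _≟ᵇ_)
open import Data.Empty using (⊥-elim)
open import Data.Fin using (Fin; zero; suc)
open import Data.Fin.Properties using (_≟_; any?)
open import Data.List as List using (List; length; _++_)
open import Data.List.Membership.Propositional using (_∈_)
open import Data.List.Membership.Propositional.Properties using (∈-map⁺; ∈-map⁻; ∈-++⁺ˡ; ∈-++⁺ʳ; ∈-++⁻)
open import Data.List.Properties using (length-map; length-++)
import Data.List.Relation.Unary.All as All
import Data.List.Relation.Unary.AllPairs as AllPairs
open import Data.List.Relation.Unary.Any using (here)
open import Data.List.Relation.Unary.Unique.Propositional using (Unique)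
import Data.List.Relation.Unary.Unique.Propositional.Properties as Unique
open import Data.Nat using (ℕ; zero; suc; _+_; _*_; _^_; _≤_; _<_; _/_; _%_; z≤n; s≤s; s≤s⁻¹; ⌊_/2⌋)
open import Data.Nat.Combinatorics using (_C_; nCk+nC[k+1]≡[n+1]C[k+1])
open import Data.Nat.DivMod using (m≡m%n+[m/n]*n; m*n/n≡m)
open import Data.Nat.Properties hiding (_≟_)
open import Algebra.Properties.Semiring.Sum +-*-semiring
  using (sum; ∑-distrib-+; *-distribʳ-sum; sum-cong-≗; sum-replicate-zero)
open import Data.Nat.Tactic.RingSolver using (solve-∀)
open import Data.Product using (Σ; ∃; _×_; _,_; proj₁; proj₂)
open import Data.Sum using (_⊎_; inj₁; inj₂; [_,_]′)
open import Data.Vec as Vec using (Vec; []; _∷_; lookup; tabulate)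
open import Data.Vec.Properties
  using (≡-dec; ∷-injectiveˡ; ∷-injectiveʳ; lookup∘tabulate; tabulate∘lookup; tabulate-cong)
open import Function using (_∘_; id; case_of_)
open import Relation.Binary.PropositionalEquality
open import Relation.Nullary using (¬_; yes; no; does)
open import Relation.Nullary.Decidable using (dec-true; dec-false; ¬?; _×-dec_)

open import Defs

private variable
  n p : ℕ

𝟙 : Bool → ℕ
𝟙 true  = 1
𝟙 false = 0

𝟙≤1 : ∀ b → 𝟙 b ≤ 1
𝟙≤1 true  = ≤-refl
𝟙≤1 false = z≤n

𝟙-injective : ∀ {b c} → 𝟙 b ≡ 𝟙 c → b ≡ c
𝟙-injective {true}  {true}  _ = refl
𝟙-injective {false} {false} _ = refl

𝟙+𝟙-not : ∀ b → 𝟙 b + 𝟙 (not b) ≡ 1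
𝟙+𝟙-not true  = refl
𝟙+𝟙-not false = refl

sum-mono-≤ : {f g : Fin n → ℕ} → (∀ i → f i ≤ g i) → sum f ≤ sum g
sum-mono-≤ {zero}  f≤g = z≤n
sum-mono-≤ {suc n} f≤g = +-mono-≤ (f≤g zero) (sum-mono-≤ (f≤g ∘ suc))

+-≤-≤-≡⇒≡ : ∀ {a b c d} → a ≤ b → c ≤ d → a + c ≡ b + d → a ≡ b × c ≡ d
+-≤-≤-≡⇒≡ {a} {b} {c} {d} a≤b c≤d a+c≡b+d =
  a≡b , +-cancelˡ-≡ a c d (trans a+c≡b+d (cong (_+ d) (sym a≡b)))
  where
  a≡b : a ≡ b
  a≡b = ≤-antisym a≤b (+-cancelʳ-≤ d b a (≤-trans (≤-reflexive (sym a+c≡b+d)) (+-monoʳ-≤ a c≤d)))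

sum-mono-≤-≡⇒≗ : {f g : Fin n → ℕ} → (∀ i → f i ≤ g i) → sum f ≡ sum g → ∀ i → f i ≡ g i
sum-mono-≤-≡⇒≗ {suc n} f≤g Σf≡Σg
  with f0≡g0 , rest ← +-≤-≤-≡⇒≡ (f≤g zero) (sum-mono-≤ (f≤g ∘ suc)) Σf≡Σg = λ where
    zero    → f0≡g0
    (suc i) → sum-mono-≤-≡⇒≗ (f≤g ∘ suc) rest i

sum-𝟙-≟ : (a : Fin n) → sum (λ i → 𝟙 (does (i ≟ a))) ≡ 1
sum-𝟙-≟ {suc n} zero    = cong suc (sum-replicate-zero n)
sum-𝟙-≟ {suc n} (suc a) = sum-𝟙-≟ a

sum-vec-map : {A : Set} (f : A → ℕ) (v : Vec A n) → Vec.sum (Vec.map f v) ≡ sum (λ i → f (lookup v i))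
sum-vec-map f []      = refl
sum-vec-map f (x ∷ v) = cong (f x +_) (sum-vec-map f v)

-- Distances and shortest paths in S_p^2

mismatch : Fin p → Fin p → ℕ
mismatch x y = 𝟙 (not (does (x ≟ y)))

mismatch-refl : (x : Fin p) → mismatch x x ≡ 0
mismatch-refl x rewrite dec-true (x ≟ x) refl = refl

mismatch-≢ : {x y : Fin p} → x ≢ y → mismatch x y ≡ 1
mismatch-≢ {x = x} {y} x≢y rewrite dec-false (x ≟ y) x≢y = refl

mismatch≤1 : (x y : Fin p) → mismatch x y ≤ 1
mismatch≤1 x y = 𝟙≤1 _

dist : Word p 2 → Word p 2 → ℕ
dist (a ∷ b ∷ []) (c ∷ d ∷ []) = if does (a ≟ c) then mismatch b d else mismatch b c + suc (mismatch a d)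

dist-≡ : (a b d : Fin p) → dist (a ∷ b ∷ []) (a ∷ d ∷ []) ≡ mismatch b d
dist-≡ a b d rewrite dec-true (a ≟ a) refl = refl

dist-≢ : {a c : Fin p} (b d : Fin p) → a ≢ c →
         dist (a ∷ b ∷ []) (c ∷ d ∷ []) ≡ mismatch b c + suc (mismatch a d)
dist-≢ {a = a} {c} b d a≢c rewrite dec-false (a ≟ c) a≢c = refl

dist-refl : (u : Word p 2) → dist u u ≡ 0
dist-refl (a ∷ b ∷ []) = trans (dist-≡ a b b) (mismatch-refl b)

dist-pos : {u v : Word p 2} → u ≢ v → 1 ≤ dist u v
dist-pos {u = a ∷ b ∷ []} {c ∷ d ∷ []} u≢v with a ≟ c
... | no _ = ≤-trans (s≤s z≤n) (m≤n+m (suc (mismatch a d)) (mismatch b c))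
... | yes refl with b ≟ d
...   | yes refl = ⊥-elim (u≢v refl)
...   | no _ = ≤-refl

dist-within-copy≤1 : (a b d : Fin p) → dist (a ∷ b ∷ []) (a ∷ d ∷ []) ≤ 1
dist-within-copy≤1 a b d rewrite dist-≡ a b d = mismatch≤1 b d

adj-bridge : {a c : Fin p} → a ≢ c → Adj p 2 (a ∷ c ∷ []) (c ∷ a ∷ [])
adj-bridge a≢c = zero , (λ _ ()) , a≢c , λ { zero () ; (suc zero) _ → refl , refl }

adj-within-copy : {a b d : Fin p} → b ≢ d → Adj p 2 (a ∷ b ∷ []) (a ∷ d ∷ [])
adj-within-copy b≢d =
  suc zero , (λ { zero _ → refl ; (suc zero) (s≤s ()) }) , b≢d , λ { zero () ; (suc zero) (s≤s ()) }

adj-cases : {a b : Fin p} {w : Word p 2} → Adj p 2 (a ∷ b ∷ []) w →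
            (w ≡ b ∷ a ∷ [] × a ≢ b) ⊎ (∃ λ d → w ≡ a ∷ d ∷ [] × b ≢ d)
adj-cases {w = _ ∷ d ∷ []} (zero , _ , a≢c , after) with after (suc zero) (s≤s z≤n)
... | refl , refl = inj₁ (refl , a≢c)
adj-cases {w = _ ∷ d ∷ []} (suc zero , before , b≢d , _) with before zero (s≤s z≤n)
... | refl = inj₂ (d , refl , b≢d)

dist-step : (u w v : Word p 2) → Adj p 2 u w → dist u v ≤ suc (dist w v)
dist-step (a ∷ b ∷ []) w (c ∷ d ∷ []) u~w with a ≟ c | adj-cases {w = w} u~w
... | yes refl | _ = ≤-trans (mismatch≤1 b d) (s≤s z≤n)
... | no a≢c | inj₂ (b′ , refl , _) rewrite dist-≢ b′ d a≢c =
  +-monoˡ-≤ (suc (mismatch a d)) (≤-trans (mismatch≤1 b c) (s≤s z≤n))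
... | no a≢c | inj₁ (refl , _) with b ≟ c
...   | yes refl = ≤-refl
...   | no _ rewrite mismatch-≢ a≢c =
  s≤s (s≤s (≤-trans (mismatch≤1 a d) (s≤s z≤n)))

dist≤length : {u v : Word p 2} {k : ℕ} → Walk p 2 u v k → dist u v ≤ k
dist≤length (stay u) = ≤-reflexive (dist-refl u)
dist≤length {u = u} {v} (step {w = w} u~w W) = ≤-trans (dist-step u w v u~w) (s≤s (dist≤length W))

dist-via-walk : {u v x : Word p 2} {k : ℕ} {P : Walk p 2 u v k} → OnWalk x P → dist u x + dist x v ≤ k
dist-via-walk {x = x} here-stay rewrite dist-refl x = z≤n
dist-via-walk {x = x} (here-step x~w W) rewrite dist-refl x = dist≤length (step {u = x} x~w W)
dist-via-walk {u = u} {v} {x} (there {w = w} u~w W x∈W) =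
  ≤-trans (+-monoˡ-≤ (dist x v) (dist-step u w x u~w)) (s≤s (dist-via-walk {u = w} x∈W))

_++ᵂ_ : {u w v : Word p 2} {k l : ℕ} → Walk p 2 u w k → Walk p 2 w v l → Walk p 2 u v (k + l)
stay _     ++ᵂ Q = Q
step u~w P ++ᵂ Q = step u~w (P ++ᵂ Q)

onWalk-start : {u v : Word p 2} {k : ℕ} (P : Walk p 2 u v k) → OnWalk u P
onWalk-start (stay u)     = here-stay
onWalk-start (step u~w P) = here-step u~w P

onWalk-++ʳ : {u w v x : Word p 2} {k l : ℕ} (P : Walk p 2 u w k) {Q : Walk p 2 w v l} →
             OnWalk x Q → OnWalk x (P ++ᵂ Q)
onWalk-++ʳ (stay _)     x∈Q = x∈Q
onWalk-++ʳ (step u~w P) x∈Q = there u~w _ (onWalk-++ʳ P x∈Q)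

within-copy-walk : (a b d : Fin p) → Walk p 2 (a ∷ b ∷ []) (a ∷ d ∷ []) (mismatch b d)
within-copy-walk a b d with b ≟ d
... | yes refl = stay _
... | no b≢d   = step (adj-within-copy b≢d) (stay _)

geodesic : (u v : Word p 2) → Walk p 2 u v (dist u v)
geodesic (a ∷ b ∷ []) (c ∷ d ∷ []) with a ≟ c
... | yes refl = within-copy-walk a b d
... | no a≢c   = within-copy-walk a b c ++ᵂ step (adj-bridge a≢c) (within-copy-walk c a d)

Between : Word p 2 → Word p 2 → Word p 2 → Set
Between u x v = dist u x + dist x v ≤ dist u v

shortest-via⇒between : {u v x : Word p 2} {k : ℕ} {P : Walk p 2 u v k} →
                       IsShortest P → OnWalk x P → Between u x v
shortest-via⇒between {u = u} {v} shortest x∈P = ≤-trans (dist-via-walk x∈P) (shortest _ (geodesic u v))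

between⇒shortest-via : {u v x : Word p 2} → Between u x v →
                       Σ (Walk p 2 u v (dist u x + dist x v)) λ P → IsShortest P × OnWalk x P
between⇒shortest-via {u = u} {v} {x} u-x-v =
  geodesic u x ++ᵂ geodesic x v ,
  (λ m W → ≤-trans u-x-v (dist≤length W)) ,
  onWalk-++ʳ (geodesic u x) (onWalk-start (geodesic x v))

NoneBetween : VSet p 2 → Set
NoneBetween X = ∀ {u v x} → u ∈V X → v ∈V X → x ∈V X → u ≢ v → Between u x v → x ≡ u ⊎ x ≡ v

isGPSet⇒noneBetween : {X : VSet p 2} → IsGPSet X → NoneBetween X
isGPSet⇒noneBetween gp u∈X v∈X x∈X u≢v u-x-v =
  let P , shortest , x∈P = between⇒shortest-via u-x-v in gp _ _ u∈X v∈X u≢v P shortest _ x∈P x∈X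

noneBetween⇒isGPSet : {X : VSet p 2} → NoneBetween X → IsGPSet X
noneBetween⇒isGPSet none u v u∈X v∈X u≢v P shortest x x∈P x∈X =
  none u∈X v∈X x∈X u≢v (shortest-via⇒between shortest x∈P)

between-bridge : {a b c : Fin p} (d : Fin p) → a ≢ c → b ≢ c →
                 Between (a ∷ b ∷ []) (a ∷ c ∷ []) (c ∷ d ∷ [])
between-bridge {a = a} {b} {c} d a≢c b≢c
  rewrite dist-≡ a b c | dist-≢ c d a≢c | dist-≢ b d a≢c | mismatch-refl c | mismatch-≢ b≢c = ≤-refl

isGPSet-bridge : {X : VSet p 2} → IsGPSet X → {a b c d : Fin p} → a ≢ c → b ≢ c →
                 (a ∷ b ∷ []) ∈V X → (c ∷ d ∷ []) ∈V X → ¬ (a ∷ c ∷ []) ∈V X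
isGPSet-bridge gp {a} {b} {c} {d} a≢c b≢c ab∈X cd∈X ac∈X
  with isGPSet⇒noneBetween gp {x = a ∷ c ∷ []} ab∈X cd∈X ac∈X (a≢c ∘ ∷-injectiveˡ) (between-bridge d a≢c b≢c)
... | inj₁ ac≡ab = b≢c (sym (∷-injectiveˡ (∷-injectiveʳ ac≡ab)))
... | inj₂ ac≡cd = a≢c (∷-injectiveˡ ac≡cd)

∣_∣ : (Fin n → Bool) → ℕ
∣ A ∣ = sum λ i → 𝟙 (A i)

∣_∣ᶜ : (Fin n → Bool) → ℕ
∣ A ∣ᶜ = sum λ i → 𝟙 (not (A i))

sum-1 : ∀ n → sum {n} (λ _ → 1) ≡ n
sum-1 zero    = refl
sum-1 (suc n) = cong suc (sum-1 n)

∣∣+∣∣ᶜ : (A : Fin n → Bool) → ∣ A ∣ + ∣ A ∣ᶜ ≡ n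
∣∣+∣∣ᶜ {n} A = begin
  ∣ A ∣ + ∣ A ∣ᶜ                       ≡⟨ ∑-distrib-+ (𝟙 ∘ A) (𝟙 ∘ not ∘ A) ⟨
  sum (λ i → 𝟙 (A i) + 𝟙 (not (A i)))  ≡⟨ sum-cong-≗ (𝟙+𝟙-not ∘ A) ⟩
  sum {n} (λ _ → 1)                    ≡⟨ sum-1 n ⟩
  n                                    ∎
  where open ≡-Reasoning

∣∣ᶜ≡ : ∀ {m} (A : Fin n → Bool) → ∣ A ∣ + m ≡ n → ∣ A ∣ᶜ ≡ m
∣∣ᶜ≡ A eq = +-cancelˡ-≡ ∣ A ∣ _ _ (trans (∣∣+∣∣ᶜ A) (sym eq))

∃-∣∣≡ : ∀ {n k} → k ≤ n → ∃ λ (A : Fin n → Bool) → ∣ A ∣ ≡ k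
∃-∣∣≡ {n}     {zero}  _         = (λ _ → false) , sum-replicate-zero n
∃-∣∣≡ {suc n} {suc k} (s≤s k≤n) with A , ∣A∣≡k ← ∃-∣∣≡ k≤n =
  (λ { zero → true ; (suc i) → A i }) , cong suc ∣A∣≡k

sum-𝟙-≟+∣∣ᶜ : (A : Fin n → Bool) (a : Fin n) → sum (λ b → 𝟙 (does (b ≟ a)) + 𝟙 (not (A b))) ≡ suc ∣ A ∣ᶜ
sum-𝟙-≟+∣∣ᶜ A a = trans (∑-distrib-+ (λ b → 𝟙 (does (b ≟ a))) _) (cong (_+ ∣ A ∣ᶜ) (sum-𝟙-≟ a))

-- The canonical general position sets

lookup-ext : {A : Set} {xs ys : Vec A n} → (∀ i → lookup xs i ≡ lookup ys i) → xs ≡ ys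
lookup-ext {xs = xs} {ys} eq = trans (sym (tabulate∘lookup xs)) (trans (tabulate-cong eq) (tabulate∘lookup ys))

row : VSet p 2 → Fin p → Fin p → Bool
row X a b = lookup (lookup X a) b

card-≡-∑-rows : (X : VSet p 2) → card X ≡ sum λ a → ∣ row X a ∣
card-≡-∑-rows X = trans (sum-vec-map card X) (sum-cong-≗ λ a →
  trans (sum-vec-map card (lookup X a)) (sum-cong-≗ (card≡𝟙 ∘ row X a)))
  where
  card≡𝟙 : (b : Bool) → card {p} {0} b ≡ 𝟙 b
  card≡𝟙 true  = refl
  card≡𝟙 false = refl

canonical : (Fin p → Bool) → VSet p 2
canonical A = tabulate λ a → tabulate λ b → A a ∧ (does (b ≟ a) ∨ not (A b))

lookup-canonical : (A : Fin p → Bool) (a b : Fin p) →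
                   row (canonical A) a b ≡ (A a ∧ (does (b ≟ a) ∨ not (A b)))
lookup-canonical A a b =
  trans (cong (λ r → lookup r b) (lookup∘tabulate _ a)) (lookup∘tabulate _ b)

canonical-cong : {A B : Fin p → Bool} → (∀ a → A a ≡ B a) → canonical A ≡ canonical B
canonical-cong A≗B = tabulate-cong λ a → tabulate-cong λ b →
  cong₂ (λ x y → x ∧ (does (b ≟ a) ∨ not y)) (A≗B a) (A≗B b)

∈-canonical⁻ : (A : Fin p → Bool) {a b : Fin p} → (a ∷ b ∷ []) ∈V canonical A →
              A a ≡ true × (b ≡ a ⊎ A b ≡ false)
∈-canonical⁻ A {a} {b} ab∈ with A a | b ≟ a | A b | trans (sym (lookup-canonical A a b)) ab∈
... | true | yes b≡a | _     | _ = refl , inj₁ b≡a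
... | true | no _    | false | _ = refl , inj₂ refl

canonical-avoids : (A : Fin p → Bool) {a b c d : Fin p} →
  (a ∷ b ∷ []) ∈V canonical A → (c ∷ d ∷ []) ∈V canonical A → c ≢ a → b ≢ c
canonical-avoids A ab∈ cd∈ c≢a refl with ∈-canonical⁻ A ab∈ | ∈-canonical⁻ A cd∈
... | _ , inj₁ c≡a   | _         = c≢a c≡a
... | _ , inj₂ Ac≡ff | Ac≡tt , _ = case trans (sym Ac≡ff) Ac≡tt of λ ()

canonical-dist-≢ : (A : Fin p → Bool) {a b c d : Fin p} →
  (a ∷ b ∷ []) ∈V canonical A → (c ∷ d ∷ []) ∈V canonical A → a ≢ c → dist (a ∷ b ∷ []) (c ∷ d ∷ []) ≡ 3
canonical-dist-≢ A {b = b} {d = d} ab∈ cd∈ a≢c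
  rewrite dist-≢ b d a≢c | mismatch-≢ (canonical-avoids A ab∈ cd∈ (a≢c ∘ sym))
        | mismatch-≢ (canonical-avoids A cd∈ ab∈ a≢c ∘ sym) = refl

canonical-strict-triangle : (A : Fin p → Bool) {u v x : Word p 2} →
  u ∈V canonical A → v ∈V canonical A → x ∈V canonical A → x ≢ u → x ≢ v → dist u v < dist u x + dist x v
canonical-strict-triangle A {u@(a ∷ b ∷ [])} {v@(c ∷ d ∷ [])} {x@(e ∷ f ∷ [])} u∈ v∈ x∈ x≢u x≢v =
  case a ≟ c of λ where
    (yes refl) → ≤-trans (s≤s (dist-within-copy≤1 a b d)) (+-mono-≤ (dist-pos (x≢u ∘ sym)) (dist-pos x≢v))
    (no a≢c) → subst (_< dist u x + dist x v) (sym (canonical-dist-≢ A u∈ v∈ a≢c)) (case e ≟ a of λ where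
      (yes refl) → +-mono-≤ (dist-pos (x≢u ∘ sym)) (≤-reflexive (sym (canonical-dist-≢ A x∈ v∈ a≢c)))
      (no e≢a)   → +-mono-≤ (≤-reflexive (sym (canonical-dist-≢ A u∈ x∈ (e≢a ∘ sym)))) (dist-pos x≢v))

isGPSet-canonical : (A : Fin p → Bool) → IsGPSet (canonical A)
isGPSet-canonical A = noneBetween⇒isGPSet none
  where
  none : NoneBetween (canonical A)
  none {u} {v} {x} u∈ v∈ x∈ _ u-x-v with ≡-dec _≟_ x u | ≡-dec _≟_ x v
  ... | yes x≡u | _       = inj₁ x≡u
  ... | no _    | yes x≡v = inj₂ x≡v
  ... | no x≢u  | no x≢v  = ⊥-elim (<⇒≱ (canonical-strict-triangle A u∈ v∈ x∈ x≢u x≢v) u-x-v)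

𝟙-self-or-outside : (A : Fin p → Bool) {a : Fin p} → A a ≡ true →
  ∀ b → 𝟙 (does (b ≟ a) ∨ not (A b)) ≡ 𝟙 (does (b ≟ a)) + 𝟙 (not (A b))
𝟙-self-or-outside A {a} Aa b with b ≟ a
... | yes refl rewrite Aa = refl
... | no _     = refl

∣canonical-row∣ : (A : Fin p → Bool) (a : Fin p) → ∣ row (canonical A) a ∣ ≡ 𝟙 (A a) * suc ∣ A ∣ᶜ
∣canonical-row∣ {p} A a = trans (sum-cong-≗ (cong 𝟙 ∘ lookup-canonical A a)) (by-membership (A a) refl)
  where
  by-membership : ∀ t → A a ≡ t → sum (λ b → 𝟙 (t ∧ (does (b ≟ a) ∨ not (A b)))) ≡ 𝟙 t * suc ∣ A ∣ᶜ
  by-membership false _  = sum-replicate-zero p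
  by-membership true  Aa = begin
    sum (λ b → 𝟙 (does (b ≟ a) ∨ not (A b)))      ≡⟨ sum-cong-≗ (𝟙-self-or-outside A Aa) ⟩
    sum (λ b → 𝟙 (does (b ≟ a)) + 𝟙 (not (A b)))  ≡⟨ sum-𝟙-≟+∣∣ᶜ A a ⟩
    suc ∣ A ∣ᶜ                                     ≡⟨ +-identityʳ _ ⟨
    1 * suc ∣ A ∣ᶜ                                 ∎
    where open ≡-Reasoning

card-canonical : (A : Fin p → Bool) → card (canonical A) ≡ ∣ A ∣ * suc ∣ A ∣ᶜ
card-canonical A = begin
  card (canonical A)                   ≡⟨ card-≡-∑-rows (canonical A) ⟩
  sum (λ a → ∣ row (canonical A) a ∣)  ≡⟨ sum-cong-≗ (∣canonical-row∣ A) ⟩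
  sum (λ a → 𝟙 (A a) * suc ∣ A ∣ᶜ)     ≡⟨ *-distribʳ-sum (suc ∣ A ∣ᶜ) (𝟙 ∘ A) ⟨
  ∣ A ∣ * suc ∣ A ∣ᶜ                   ∎
  where open ≡-Reasoning

canonical-injective : {A B : Vec Bool p} → canonical (lookup A) ≡ canonical (lookup B) → A ≡ B
canonical-injective {A = A} {B} eq = lookup-ext diagonal
  where
  diagonal-canonical : ∀ D a → row (canonical D) a a ≡ D a
  diagonal-canonical D a rewrite lookup-canonical D a a | dec-true (a ≟ a) refl = ∧-identityʳ (D a)
  diagonal : ∀ a → lookup A a ≡ lookup B a
  diagonal a = trans (sym (diagonal-canonical (lookup A) a))
                     (trans (cong (λ X → row X a a) eq) (diagonal-canonical (lookup B) a))

-- The rows of a general position set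

occupied : VSet p 2 → Fin p → Bool
occupied X a = does (any? λ b → row X a b ≟ᵇ true)

occupied⇒∃ : {X : VSet p 2} {a : Fin p} → occupied X a ≡ true → ∃ λ b → row X a b ≡ true
occupied⇒∃ {X = X} {a} occ with any? (λ b → row X a b ≟ᵇ true)
... | yes ∃b = ∃b

unoccupied⇒empty : {X : VSet p 2} {a : Fin p} → occupied X a ≡ false → ∀ b → row X a b ≡ false
unoccupied⇒empty {X = X} {a} unocc b with any? (λ b → row X a b ≟ᵇ true) | row X a b in Xab
... | no ∄b | true  = ⊥-elim (∄b (b , Xab))
... | no _  | false = refl

-- Either row a contains a c for some other occupied row c, and then isGPSet-bridge leaves
-- no other vertex in row a, or row a lies in {a} ∪ (unoccupied rows).
isGPSet-occupied-row : {X : VSet p 2} → IsGPSet X → (a : Fin p) → occupied X a ≡ true →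
  ∣ row X a ∣ ≤ 1 ⊎ (∀ b → 𝟙 (row X a b) ≤ 𝟙 (does (b ≟ a)) + 𝟙 (not (occupied X b)))
isGPSet-occupied-row {X = X} gp a _
  with any? (λ c → ¬? (c ≟ a) ×-dec (occupied X c ≟ᵇ true) ×-dec (row X a c ≟ᵇ true))
... | yes (c , c≢a , occ-c , ac∈X) = inj₁ (≤-trans (sum-mono-≤ only-c) (≤-reflexive (sum-𝟙-≟ c)))
  where
  only-c : ∀ b → 𝟙 (row X a b) ≤ 𝟙 (does (b ≟ c))
  only-c b with row X a b in ab∈X | b ≟ c
  ... | false | _        = z≤n
  ... | true  | yes _    = ≤-refl
  ... | true  | no b≢c   = ⊥-elim (isGPSet-bridge gp (c≢a ∘ sym) b≢c ab∈X (proj₂ (occupied⇒∃ {X = X} occ-c)) ac∈X)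
... | no ∄c = inj₂ within
  where
  within : ∀ b → 𝟙 (row X a b) ≤ 𝟙 (does (b ≟ a)) + 𝟙 (not (occupied X b))
  within b with row X a b in ab∈X | b ≟ a | occupied X b in occ-b
  ... | false | _     | _     = z≤n
  ... | true  | yes _ | _     = s≤s z≤n
  ... | true  | no _  | false = ≤-refl
  ... | true  | no b≢a | true = ⊥-elim (∄c (b , b≢a , occ-b , ab∈X))

isGPSet-row-size≤ : {X : VSet p 2} → IsGPSet X → ∀ a → ∣ row X a ∣ ≤ 𝟙 (occupied X a) * suc ∣ occupied X ∣ᶜ
isGPSet-row-size≤ {p} {X} gp a with occupied X a in occ-a
... | false = ≤-reflexive (trans (sum-cong-≗ (cong 𝟙 ∘ unoccupied⇒empty {X = X} occ-a)) (sum-replicate-zero p))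
... | true with isGPSet-occupied-row gp a occ-a
...   | inj₁ ∣row∣≤1 = ≤-trans ∣row∣≤1 (s≤s z≤n)
...   | inj₂ within  =
  ≤-trans (sum-mono-≤ within) (≤-reflexive (trans (sum-𝟙-≟+∣∣ᶜ (occupied X) a) (sym (+-identityʳ _))))

isGPSet-card≤ : {X : VSet p 2} → IsGPSet X → card X ≤ ∣ occupied X ∣ * suc ∣ occupied X ∣ᶜ
isGPSet-card≤ {X = X} gp = begin
  card X
    ≡⟨ card-≡-∑-rows X ⟩
  sum (λ a → ∣ row X a ∣)
    ≤⟨ sum-mono-≤ (isGPSet-row-size≤ gp) ⟩
  sum (λ a → 𝟙 (occupied X a) * suc ∣ occupied X ∣ᶜ)
    ≡⟨ *-distribʳ-sum (suc ∣ occupied X ∣ᶜ) (𝟙 ∘ occupied X) ⟨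
  ∣ occupied X ∣ * suc ∣ occupied X ∣ᶜ ∎
  where open ≤-Reasoning

-- The hypothesis 1 ≤ ∣ occupied X ∣ᶜ excludes tight rows with a single vertex (possible for
-- p = 2); it is where 3 ≤ p enters.
isGPSet-card≡⇒canonical : {X : VSet p 2} → IsGPSet X → card X ≡ ∣ occupied X ∣ * suc ∣ occupied X ∣ᶜ →
                          1 ≤ ∣ occupied X ∣ᶜ → X ≡ canonical (occupied X)
isGPSet-card≡⇒canonical {p} {X} gp card≡ 1≤m =
  lookup-ext λ a → lookup-ext λ b → trans (entry a b) (sym (lookup-canonical (occupied X) a b))
  where
  m : ℕ
  m = ∣ occupied X ∣ᶜ
  tight : ∀ a → ∣ row X a ∣ ≡ 𝟙 (occupied X a) * suc m
  tight = sum-mono-≤-≡⇒≗ (isGPSet-row-size≤ gp)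
    (trans (sym (card-≡-∑-rows X)) (trans card≡ (*-distribʳ-sum (suc m) (𝟙 ∘ occupied X))))
  tight-occupied : ∀ {a} → occupied X a ≡ true → ∣ row X a ∣ ≡ suc m
  tight-occupied {a} occ-a = trans (tight a) (trans (cong (λ t → 𝟙 t * suc m) occ-a) (+-identityʳ (suc m)))
  entry : ∀ a b → row X a b ≡ (occupied X a ∧ (does (b ≟ a) ∨ not (occupied X b)))
  entry a b with occupied X a in occ-a
  ... | false = unoccupied⇒empty {X = X} occ-a b
  ... | true with isGPSet-occupied-row gp a occ-a
  ...   | inj₁ ∣row∣≤1 = ⊥-elim (<⇒≱ (s≤s 1≤m) (subst (_≤ 1) (tight-occupied occ-a) ∣row∣≤1))
  ...   | inj₂ within  = 𝟙-injective (trans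
          (sum-mono-≤-≡⇒≗ within (trans (tight-occupied occ-a) (sym (sum-𝟙-≟+∣∣ᶜ (occupied X) a))) b)
          (sym (𝟙-self-or-outside (occupied X) occ-a b)))

ofSize : (n k : ℕ) → List (Vec Bool n)
ofSize zero    zero    = List.[ [] ]
ofSize zero    (suc k) = List.[]
ofSize (suc n) zero    = List.map (false ∷_) (ofSize n zero)
ofSize (suc n) (suc k) = List.map (true ∷_) (ofSize n k) ++ List.map (false ∷_) (ofSize n (suc k))

length-ofSize : ∀ n k → length (ofSize n k) ≡ n C k
length-ofSize zero    zero    = refl
length-ofSize zero    (suc k) = refl
length-ofSize (suc n) zero    = trans (length-map (false ∷_) (ofSize n zero)) (length-ofSize n zero)
length-ofSize (suc n) (suc k) = begin
  length (List.map (true ∷_) (ofSize n k) ++ List.map (false ∷_) (ofSize n (suc k)))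
    ≡⟨ length-++ (List.map (true ∷_) (ofSize n k)) ⟩
  length (List.map (true ∷_) (ofSize n k)) + length (List.map (false ∷_) (ofSize n (suc k)))
    ≡⟨ cong₂ _+_ (length-map (true ∷_) (ofSize n k)) (length-map (false ∷_) (ofSize n (suc k))) ⟩
  length (ofSize n k) + length (ofSize n (suc k))
    ≡⟨ cong₂ _+_ (length-ofSize n k) (length-ofSize n (suc k)) ⟩
  n C k + n C suc k
    ≡⟨ nCk+nC[k+1]≡[n+1]C[k+1] n k ⟩
  suc n C suc k ∎
  where open ≡-Reasoning

∈-ofSize⁻ : ∀ {n} k {A : Vec Bool n} → A ∈ ofSize n k → ∣ lookup A ∣ ≡ k
∈-ofSize⁻ {zero}  zero    (here refl) = refl
∈-ofSize⁻ {suc n} zero    A∈ with _ , A′∈ , refl ← ∈-map⁻ (false ∷_) A∈ = ∈-ofSize⁻ zero A′∈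
∈-ofSize⁻ {suc n} (suc k) A∈ with ∈-++⁻ (List.map (true ∷_) (ofSize n k)) A∈
... | inj₁ A∈ᵗ with _ , A′∈ , refl ← ∈-map⁻ (true ∷_) A∈ᵗ = cong suc (∈-ofSize⁻ k A′∈)
... | inj₂ A∈ᶠ with _ , A′∈ , refl ← ∈-map⁻ (false ∷_) A∈ᶠ = ∈-ofSize⁻ (suc k) A′∈

∈-ofSize⁺ : ∀ {n} k (A : Fin n → Bool) → ∣ A ∣ ≡ k → tabulate A ∈ ofSize n k
∈-ofSize⁺ {zero}  zero    A _ = here refl
∈-ofSize⁺ {suc n} k       A ∣A∣≡k with A zero
∈-ofSize⁺ {suc n} (suc k) A ∣A∣≡k | true  =
  ∈-++⁺ˡ (∈-map⁺ (true ∷_) (∈-ofSize⁺ k (A ∘ suc) (suc-injective ∣A∣≡k)))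
∈-ofSize⁺ {suc n} zero    A ∣A∣≡k | false = ∈-map⁺ (false ∷_) (∈-ofSize⁺ zero (A ∘ suc) ∣A∣≡k)
∈-ofSize⁺ {suc n} (suc k) A ∣A∣≡k | false =
  ∈-++⁺ʳ (List.map (true ∷_) (ofSize n k)) (∈-map⁺ (false ∷_) (∈-ofSize⁺ (suc k) (A ∘ suc) ∣A∣≡k))

ofSize-unique : ∀ n k → Unique (ofSize n k)
ofSize-unique zero    zero    = All.[] AllPairs.∷ AllPairs.[]
ofSize-unique zero    (suc k) = AllPairs.[]
ofSize-unique (suc n) zero    = Unique.map⁺ ∷-injectiveʳ (ofSize-unique n zero)
ofSize-unique (suc n) (suc k) =
  Unique.++⁺ (Unique.map⁺ ∷-injectiveʳ (ofSize-unique n k)) (Unique.map⁺ ∷-injectiveʳ (ofSize-unique n (suc k)))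
             heads-differ
  where
  heads-differ : ∀ {A} → ¬ (A ∈ List.map (true ∷_) (ofSize n k) × A ∈ List.map (false ∷_) (ofSize n (suc k)))
  heads-differ (A∈ᵗ , A∈ᶠ) with _ , _ , refl ← ∈-map⁻ (true ∷_) A∈ᵗ | _ , _ , () ← ∈-map⁻ (false ∷_) A∈ᶠ

gpNumber-S² : (G : ℕ) → (∀ (A : Fin p → Bool) → ∣ A ∣ * suc ∣ A ∣ᶜ ≤ G) →
              (∃ λ (A : Fin p → Bool) → ∣ A ∣ * suc ∣ A ∣ᶜ ≡ G) → GPNumber p 2 G
gpNumber-S² G bound (A₀ , optimal) =
  (canonical A₀ , isGPSet-canonical A₀ , trans (card-canonical A₀) optimal) ,
  λ X gp → ≤-trans (isGPSet-card≤ gp) (bound (occupied X))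

numGPSetsOfSize-S² : (G : ℕ) (Ks : List (Vec Bool p)) → Unique Ks →
  (∀ (A : Fin p → Bool) → ∣ A ∣ * suc ∣ A ∣ᶜ ≤ G) →
  (∀ (A : Fin p → Bool) → ∣ A ∣ * suc ∣ A ∣ᶜ ≡ G → 1 ≤ ∣ A ∣ᶜ × tabulate A ∈ Ks) →
  (∀ {A} → A ∈ Ks → ∣ lookup A ∣ * suc ∣ lookup A ∣ᶜ ≡ G) →
  NumGPSetsOfSize p 2 G (length Ks)
numGPSetsOfSize-S² G Ks unique bound complete sound =
  List.map (canonical ∘ lookup) Ks , Unique.map⁺ canonical-injective unique ,
  All.tabulate listed⇒optimal , optimal⇒listed , length-map (canonical ∘ lookup) Ks
  where
  listed⇒optimal : ∀ {X} → X ∈ List.map (canonical ∘ lookup) Ks → IsGPSet X × card X ≡ G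
  listed⇒optimal X∈ with A , A∈Ks , refl ← ∈-map⁻ (canonical ∘ lookup) X∈ =
    isGPSet-canonical (lookup A) , trans (card-canonical (lookup A)) (sound A∈Ks)
  optimal⇒listed : ∀ X → IsGPSet X → card X ≡ G → X ∈ List.map (canonical ∘ lookup) Ks
  optimal⇒listed X gp card≡G =
    subst (_∈ _) (trans (canonical-cong (lookup∘tabulate (occupied X))) (sym X≡canonical))
          (∈-map⁺ (canonical ∘ lookup) (proj₂ (complete (occupied X) optimal)))
    where
    optimal : ∣ occupied X ∣ * suc ∣ occupied X ∣ᶜ ≡ G
    optimal = ≤-antisym (bound (occupied X)) (subst (_≤ _) card≡G (isGPSet-card≤ gp))
    X≡canonical : X ≡ canonical (occupied X)
    X≡canonical = isGPSet-card≡⇒canonical gp (trans card≡G (sym optimal)) (proj₁ (complete (occupied X) optimal))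

-- Maximising k (m + 1) subject to k + m = p

double-square : ∀ s → (s + s) * (s + s) ≡ 4 * (s * s)
double-square = solve-∀

odd-square : ∀ s → suc (s + s) * suc (s + s) ≡ 4 * (s * suc s) + 1
odd-square = solve-∀

square-of-sum : ∀ x y → ∃ λ d → (x + y) * (x + y) ≡ 4 * (x * y) + d * d × (x ≡ y + d ⊎ y ≡ x + d)
square-of-sum x y with ≤-total x y
... | inj₁ x≤y with d , refl ← m≤n⇒∃[o]m+o≡n x≤y = d , identity x d , inj₂ refl
  where
  identity : ∀ x d → (x + (x + d)) * (x + (x + d)) ≡ 4 * (x * (x + d)) + d * d
  identity = solve-∀
... | inj₂ y≤x with d , refl ← m≤n⇒∃[o]m+o≡n y≤x = d , identity y d , inj₁ refl
  where
  identity : ∀ y d → ((y + d) + y) * ((y + d) + y) ≡ 4 * ((y + d) * y) + d * d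
  identity = solve-∀

+-double-injective : ∀ {x s} → x + x ≡ s + s → x ≡ s
+-double-injective {x} {s} eq = trans (n≡⌊n+n/2⌋ x) (trans (cong ⌊_/2⌋ eq) (sym (n≡⌊n+n/2⌋ s)))

x+y≡2s⇒x*y≤s*s : ∀ x y s → x + y ≡ s + s → x * y ≤ s * s
x+y≡2s⇒x*y≤s*s x y s x+y≡2s with d , sq , _ ← square-of-sum x y = *-cancelˡ-≤ 4 (begin
  4 * (x * y)          ≤⟨ m≤m+n _ (d * d) ⟩
  4 * (x * y) + d * d  ≡⟨ sq ⟨
  (x + y) * (x + y)    ≡⟨ cong (λ z → z * z) x+y≡2s ⟩
  (s + s) * (s + s)    ≡⟨ double-square s ⟩
  4 * (s * s)          ∎)
  where open ≤-Reasoning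

x+y≡2s⇒x*y≡s*s⇒x≡s : ∀ x y s → x + y ≡ s + s → x * y ≡ s * s → x ≡ s
x+y≡2s⇒x*y≡s*s⇒x≡s x y s x+y≡2s xy≡ss with d , sq , x≡y+d⊎y≡x+d ← square-of-sum x y =
  +-double-injective (trans (cong (x +_) x≡y) x+y≡2s)
  where
  d*d≡0 : d * d ≡ 0
  d*d≡0 = +-cancelˡ-≡ (4 * (x * y)) (d * d) 0 (begin
    4 * (x * y) + d * d  ≡⟨ sq ⟨
    (x + y) * (x + y)    ≡⟨ cong (λ z → z * z) x+y≡2s ⟩
    (s + s) * (s + s)    ≡⟨ double-square s ⟩
    4 * (s * s)          ≡⟨ cong (4 *_) xy≡ss ⟨
    4 * (x * y)          ≡⟨ +-identityʳ _ ⟨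
    4 * (x * y) + 0      ∎)
    where open ≡-Reasoning
  d≡0 : d ≡ 0
  d≡0 = [ id , id ]′ (m*n≡0⇒m≡0∨n≡0 d d*d≡0)
  x≡y : x ≡ y
  x≡y = [ (λ x≡y+d → trans x≡y+d (trans (cong (y +_) d≡0) (+-identityʳ y)))
        , (λ y≡x+d → sym (trans y≡x+d (trans (cong (x +_) d≡0) (+-identityʳ x))))
        ]′ x≡y+d⊎y≡x+d

x+y≡2s+1⇒x*y≤s*[1+s] : ∀ x y s → x + y ≡ suc (s + s) → x * y ≤ s * suc s
x+y≡2s+1⇒x*y≤s*[1+s] x y s x+y≡2s+1 with d , sq , _ ← square-of-sum x y =
  s≤s⁻¹ (*-cancelˡ-< 4 (x * y) (suc (s * suc s)) (begin-strict
    4 * (x * y)                ≤⟨ m≤m+n _ (d * d) ⟩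
    4 * (x * y) + d * d        ≡⟨ sq ⟨
    (x + y) * (x + y)          ≡⟨ cong (λ z → z * z) x+y≡2s+1 ⟩
    suc (s + s) * suc (s + s)  ≡⟨ odd-square s ⟩
    4 * (s * suc s) + 1        <⟨ +-monoʳ-< (4 * (s * suc s)) (s≤s (s≤s z≤n)) ⟩
    4 * (s * suc s) + 4        ≡⟨ trans (+-comm _ 4) (sym (*-suc 4 (s * suc s))) ⟩
    4 * suc (s * suc s)        ∎))
  where open ≤-Reasoning

x+y≡2s+1⇒x*y≡s*[1+s]⇒x≡s∨x≡1+s : ∀ x y s → x + y ≡ suc (s + s) → x * y ≡ s * suc s → x ≡ s ⊎ x ≡ suc s
x+y≡2s+1⇒x*y≡s*[1+s]⇒x≡s∨x≡1+s x y s x+y≡2s+1 xy≡s[1+s]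
  with d , sq , x≡y+d⊎y≡x+d ← square-of-sum x y
  with m*n≡1⇒m≡1 d d (+-cancelˡ-≡ (4 * (x * y)) (d * d) 1 (begin
    4 * (x * y) + d * d        ≡⟨ sq ⟨
    (x + y) * (x + y)          ≡⟨ cong (λ z → z * z) x+y≡2s+1 ⟩
    suc (s + s) * suc (s + s)  ≡⟨ odd-square s ⟩
    4 * (s * suc s) + 1        ≡⟨ cong (λ z → 4 * z + 1) xy≡s[1+s] ⟨
    4 * (x * y) + 1            ∎))
  where open ≡-Reasoning
... | refl with x≡y+d⊎y≡x+d
... | inj₁ refl = inj₂ (trans (+-comm y 1) (cong suc (+-double-injective y+y≡s+s)))
  where
  y+y≡s+s : y + y ≡ s + s
  y+y≡s+s = suc-injective (trans (cong (_+ y) (+-comm 1 y)) x+y≡2s+1)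
... | inj₂ refl = inj₁ (+-double-injective x+x≡s+s)
  where
  x+x≡s+s : x + x ≡ s + s
  x+x≡s+s = suc-injective (trans (sym (+-suc x x)) (trans (cong (x +_) (+-comm 1 x)) x+y≡2s+1))

gp-S²[1+2q] : ∀ q → 1 ≤ q →
  GPNumber (suc (q + q)) 2 (suc q * suc q) ×
  NumGPSetsOfSize (suc (q + q)) 2 (suc q * suc q) (suc (q + q) C suc q)
gp-S²[1+2q] q 1≤q =
  gpNumber-S² G bound optimum ,
  subst (NumGPSetsOfSize (suc (q + q)) 2 G) (length-ofSize (suc (q + q)) (suc q))
        (numGPSetsOfSize-S² G (ofSize (suc (q + q)) (suc q)) (ofSize-unique (suc (q + q)) (suc q))
                            bound complete sound)
  where
  G : ℕ
  G = suc q * suc q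
  size-sum : (A : Fin (suc (q + q)) → Bool) → ∣ A ∣ + suc ∣ A ∣ᶜ ≡ suc q + suc q
  size-sum A = trans (+-suc ∣ A ∣ _) (cong suc (trans (∣∣+∣∣ᶜ A) (sym (+-suc q q))))
  bound : (A : Fin (suc (q + q)) → Bool) → ∣ A ∣ * suc ∣ A ∣ᶜ ≤ G
  bound A = x+y≡2s⇒x*y≤s*s ∣ A ∣ _ (suc q) (size-sum A)
  optimal : (A : Fin (suc (q + q)) → Bool) → ∣ A ∣ ≡ suc q → ∣ A ∣ * suc ∣ A ∣ᶜ ≡ G × 1 ≤ ∣ A ∣ᶜ
  optimal A ∣A∣≡1+q = cong₂ (λ k m → k * suc m) ∣A∣≡1+q ∣A∣ᶜ≡q , subst (1 ≤_) (sym ∣A∣ᶜ≡q) 1≤q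
    where
    ∣A∣ᶜ≡q : ∣ A ∣ᶜ ≡ q
    ∣A∣ᶜ≡q = ∣∣ᶜ≡ A (cong (_+ q) ∣A∣≡1+q)
  optimum : ∃ λ (A : Fin (suc (q + q)) → Bool) → ∣ A ∣ * suc ∣ A ∣ᶜ ≡ G
  optimum with A , ∣A∣≡1+q ← ∃-∣∣≡ (s≤s (m≤m+n q q)) = A , proj₁ (optimal A ∣A∣≡1+q)
  complete : (A : Fin (suc (q + q)) → Bool) → ∣ A ∣ * suc ∣ A ∣ᶜ ≡ G →
             1 ≤ ∣ A ∣ᶜ × tabulate A ∈ ofSize (suc (q + q)) (suc q)
  complete A opt with ∣A∣≡1+q ← x+y≡2s⇒x*y≡s*s⇒x≡s ∣ A ∣ _ (suc q) (size-sum A) opt =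
    proj₂ (optimal A ∣A∣≡1+q) , ∈-ofSize⁺ (suc q) A ∣A∣≡1+q
  sound : ∀ {A} → A ∈ ofSize (suc (q + q)) (suc q) → ∣ lookup A ∣ * suc ∣ lookup A ∣ᶜ ≡ G
  sound {A} A∈ = proj₁ (optimal (lookup A) (∈-ofSize⁻ (suc q) A∈))

gp-S²[2q] : ∀ q → 2 ≤ q →
  GPNumber (q + q) 2 (q * suc q) × NumGPSetsOfSize (q + q) 2 (q * suc q) (suc (q + q) C suc q)
gp-S²[2q] q 2≤q =
  gpNumber-S² G bound optimum ,
  subst (NumGPSetsOfSize (q + q) 2 G) length-Ks (numGPSetsOfSize-S² G Ks Ks-unique bound complete sound)
  where
  G : ℕ
  G = q * suc q
  Ks : List (Vec Bool (q + q))
  Ks = ofSize (q + q) q ++ ofSize (q + q) (suc q)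
  length-Ks : length Ks ≡ suc (q + q) C suc q
  length-Ks = trans (length-++ (ofSize (q + q) q)) (trans
    (cong₂ _+_ (length-ofSize (q + q) q) (length-ofSize (q + q) (suc q))) (nCk+nC[k+1]≡[n+1]C[k+1] (q + q) q))
  Ks-unique : Unique Ks
  Ks-unique = Unique.++⁺ (ofSize-unique (q + q) q) (ofSize-unique (q + q) (suc q)) λ (A∈ , A∈′) →
    1+n≢n (trans (sym (∈-ofSize⁻ (suc q) A∈′)) (∈-ofSize⁻ q A∈))
  size-sum : (A : Fin (q + q) → Bool) → ∣ A ∣ + suc ∣ A ∣ᶜ ≡ suc (q + q)
  size-sum A = trans (+-suc ∣ A ∣ _) (cong suc (∣∣+∣∣ᶜ A))
  bound : (A : Fin (q + q) → Bool) → ∣ A ∣ * suc ∣ A ∣ᶜ ≤ G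
  bound A = x+y≡2s+1⇒x*y≤s*[1+s] ∣ A ∣ _ q (size-sum A)
  optimal : (A : Fin (q + q) → Bool) → ∣ A ∣ ≡ q ⊎ ∣ A ∣ ≡ suc q → ∣ A ∣ * suc ∣ A ∣ᶜ ≡ G × 1 ≤ ∣ A ∣ᶜ
  optimal A (inj₁ ∣A∣≡q) =
    cong₂ (λ k m → k * suc m) ∣A∣≡q ∣A∣ᶜ≡q , subst (1 ≤_) (sym ∣A∣ᶜ≡q) (≤-trans (s≤s z≤n) 2≤q)
    where
    ∣A∣ᶜ≡q : ∣ A ∣ᶜ ≡ q
    ∣A∣ᶜ≡q = ∣∣ᶜ≡ A (cong (_+ q) ∣A∣≡q)
  optimal A (inj₂ ∣A∣≡1+q) =
    trans (cong₂ _*_ ∣A∣≡1+q 1+∣A∣ᶜ≡q) (*-comm (suc q) q) , s≤s⁻¹ (subst (2 ≤_) (sym 1+∣A∣ᶜ≡q) 2≤q)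
    where
    1+∣A∣ᶜ≡q : suc ∣ A ∣ᶜ ≡ q
    1+∣A∣ᶜ≡q = +-cancelˡ-≡ q _ _ (trans (+-suc q ∣ A ∣ᶜ) (trans (cong (_+ ∣ A ∣ᶜ) (sym ∣A∣≡1+q)) (∣∣+∣∣ᶜ A)))
  optimum : ∃ λ (A : Fin (q + q) → Bool) → ∣ A ∣ * suc ∣ A ∣ᶜ ≡ G
  optimum with A , ∣A∣≡q ← ∃-∣∣≡ (m≤m+n q q) = A , proj₁ (optimal A (inj₁ ∣A∣≡q))
  complete : (A : Fin (q + q) → Bool) → ∣ A ∣ * suc ∣ A ∣ᶜ ≡ G → 1 ≤ ∣ A ∣ᶜ × tabulate A ∈ Ks
  complete A opt with x+y≡2s+1⇒x*y≡s*[1+s]⇒x≡s∨x≡1+s ∣ A ∣ _ q (size-sum A) opt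
  ... | inj₁ ∣A∣≡q   = proj₂ (optimal A (inj₁ ∣A∣≡q)) , ∈-++⁺ˡ (∈-ofSize⁺ q A ∣A∣≡q)
  ... | inj₂ ∣A∣≡1+q = proj₂ (optimal A (inj₂ ∣A∣≡1+q)) , ∈-++⁺ʳ (ofSize (q + q) q) (∈-ofSize⁺ (suc q) A ∣A∣≡1+q)
  sound : ∀ {A} → A ∈ Ks → ∣ lookup A ∣ * suc ∣ lookup A ∣ᶜ ≡ G
  sound {A} A∈ with ∈-++⁻ (ofSize (q + q) q) A∈
  ... | inj₁ A∈ᵏ  = proj₁ (optimal (lookup A) (inj₁ (∈-ofSize⁻ q A∈ᵏ)))
  ... | inj₂ A∈ᵏ⁺ = proj₁ (optimal (lookup A) (inj₂ (∈-ofSize⁻ (suc q) A∈ᵏ⁺)))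

n*2≡n+n : ∀ n → n * 2 ≡ n + n
n*2≡n+n = solve-∀

%2≡1⇒odd : ∀ {p} → p % 2 ≡ 1 → ∃ λ q → p ≡ suc (q + q)
%2≡1⇒odd {p} p%2≡1 = p / 2 , trans (m≡m%n+[m/n]*n p 2) (cong₂ _+_ p%2≡1 (n*2≡n+n (p / 2)))

%2≡0⇒even : ∀ {p} → p % 2 ≡ 0 → ∃ λ q → p ≡ q + q
%2≡0⇒even {p} p%2≡0 = p / 2 , trans (m≡m%n+[m/n]*n p 2) (cong₂ _+_ p%2≡0 (n*2≡n+n (p / 2)))

odd-closed-forms : ∀ q → (suc (q + q) + 1) ^ 2 / 4 ≡ suc q * suc q × (suc (q + q) + 1) / 2 ≡ suc q
odd-closed-forms q =
  trans (cong (_/ 4) (square q)) (m*n/n≡m (suc q * suc q) 4) ,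
  trans (cong (_/ 2) (double q)) (m*n/n≡m (suc q) 2)
  where
  square : ∀ q → (suc (q + q) + 1) * ((suc (q + q) + 1) * 1) ≡ suc q * suc q * 4
  square = solve-∀
  double : ∀ q → suc (q + q) + 1 ≡ suc q * 2
  double = solve-∀

even-closed-forms : ∀ q →
  (q + q) * (q + q + 2) / 4 ≡ q * suc q × (q + q + 2) / 2 ≡ suc q × q + q + 1 ≡ suc (q + q)
even-closed-forms q =
  trans (cong (_/ 4) (product q)) (m*n/n≡m (q * suc q) 4) ,
  trans (cong (_/ 2) (double q)) (m*n/n≡m (suc q) 2) ,
  +-comm (q + q) 1
  where
  product : ∀ q → (q + q) * (q + q + 2) ≡ q * suc q * 4
  product = solve-∀
  double : ∀ q → q + q + 2 ≡ suc q * 2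
  double = solve-∀

gp-S²-odd : ∀ p → 3 ≤ p → p % 2 ≡ 1 →
  GPNumber p 2 ((p + 1) ^ 2 / 4) × NumGPSetsOfSize p 2 ((p + 1) ^ 2 / 4) (p C ((p + 1) / 2))
gp-S²-odd p 3≤p p%2≡1 with q , refl ← %2≡1⇒odd {p} p%2≡1
  with square , half ← odd-closed-forms q
  rewrite square | half = gp-S²[1+2q] q (1≤q 3≤p)
  where
  1≤q : ∀ {q} → 3 ≤ suc (q + q) → 1 ≤ q
  1≤q {zero}  (s≤s ())
  1≤q {suc q} _ = s≤s z≤n

gp-S²-even : ∀ p → 3 ≤ p → p % 2 ≡ 0 →
  GPNumber p 2 ((p * (p + 2)) / 4) × NumGPSetsOfSize p 2 ((p * (p + 2)) / 4) ((p + 1) C ((p + 2) / 2))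
gp-S²-even p 3≤p p%2≡0 with q , refl ← %2≡0⇒even {p} p%2≡0
  with product , half , successor ← even-closed-forms q
  rewrite product | half | successor = gp-S²[2q] q (2≤q 3≤p)
  where
  2≤q : ∀ {q} → 3 ≤ q + q → 2 ≤ q
  2≤q {suc (suc q)} _ = s≤s (s≤s z≤n)
  2≤q {suc zero} (s≤s (s≤s ()))

corollary3p2 : (p : ℕ) → 3 ≤ p →
    (p % 2 ≡ 1 → GPNumber p 2 ((p + 1) ^ 2 / 4)
                 × NumGPSetsOfSize p 2 ((p + 1) ^ 2 / 4) (p C ((p + 1) / 2)))
    × (p % 2 ≡ 0 → GPNumber p 2 ((p * (p + 2)) / 4)
                 × NumGPSetsOfSize p 2 ((p * (p + 2)) / 4) ((p + 1) C ((p + 2) / 2)))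
corollary3p2 p 3≤p = gp-S²-odd p 3≤p , gp-S²-even p 3≤p
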